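{- Let $(D,T,\Phi,\Psi)$ be a $T$-model and $\rho:\mathit{Var}\to D$. If $M\longrightarrow N$ for computations $M,N$ of $\lambda_c^u$, then $[\![M]\!]^{TD}_\rho=[\![N]\!]^{TD}_\rho$. Consequently, if $M$ and $N$ are convertible (related by the equivalence relation generated by $\longrightarrow$), then $[\![M]\!]^{TD}_\rho=[\![N]\!]^{TD}_\rho$.
   Context: Syntax of $\lambda_c^u$: values $V ::= x\mid \lambda x.M$, computations $M ::= \mathit{unit}\,V\mid M\star V$. One-step reduction $\longrightarrow$ is the closure under all (value/computation) contexts of $\mathit{unit}\,V\star(\lambda x.M)\to M[V/x]$, $M\star\lambda x.\mathit{unit}\,x\to M$, and $(L\star\lambda x.M)\star\lambda y.N\to L\star\lambda x.(M\star\lambda y.N)$ for $x\notin FV(N)$. Let $\mathcal D$ be a cartesian closed subcategory of the category of posets with directed suprema and Scott-continuous maps. A monad $(T,\mathit{unit},\star)$ over $\mathcal D$ consists of a map $T$ on objects and families of morphisms $\mathit{unit}_D:D\to TD$, $\star_{D,E}:TD\times(D\to TE)\to TE$ with $(\mathit{unit}\,d)\star f=f\,d$, $a\star\mathit{unit}=a$, $(a\star f)\star g=a\star(\lambda d.\,f\,d\star g)$. A $T$-model is $(D,T,\Phi,\Psi)$ with $D$ an object, $\Phi:D\to[D\to TD]$, $\Psi:[D\to TD]\to D$ morphisms and $\Phi\circ\Psi=\mathrm{id}$. Term interpretation: $[\![x]\!]^D_\rho=\rho(x)$, $[\![\lambda x.M]\!]^D_\rho=\Psi(d\mapsto[\![M]\!]^{TD}_{\rho[x\mapsto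 d]})$, $[\![\mathit{unit}\,V]\!]^{TD}_\rho=\mathit{unit}([\![V]\!]^D_\rho)$, $[\![M\star V]\!]^{TD}_\rho=[\![M]\!]^{TD}_\rho\star\Phi([\![V]\!]^D_\rho)$. -}

module Defs where

open import Level using (Lift; lift)
open import Data.Unit using (⊤; tt)
open import Data.Nat using (ℕ; zero; suc)
open import Data.Product using (Σ; _×_; _,_; proj₁; proj₂)
open import Function using (_∘_)
open import Relation.Binary.Construct.Closure.Equivalence using (EqClosure)

record IsDirected {C : Set₁} (R : C → C → Set₁) {I : Set} (s : I → C) : Set₁ where
  field
    elt : I
    up  : ∀ i j → Σ I λ k → R (s i) (s k) × R (s j) (s k)
open IsDirected public

-- The order is a preorder _⊑_ and the
-- equality of the poset is _≈_ (mutual ⊑), i.e. posets are presented as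
-- preorders up to antisymmetry (setoid style; no quotients in Agda).
record DCPO : Set₂ where
  field
    Carrier   : Set₁
    _⊑_       : Carrier → Carrier → Set₁
    ⊑-refl    : ∀ {x} → x ⊑ x
    ⊑-trans   : ∀ {x y z} → x ⊑ y → y ⊑ z → x ⊑ z
    sup       : ∀ {I : Set} (s : I → Carrier) → IsDirected _⊑_ s → Carrier
    sup-ub    : ∀ {I : Set} (s : I → Carrier) (d : IsDirected _⊑_ s) (i : I) → s i ⊑ sup s d
    sup-least : ∀ {I : Set} (s : I → Carrier) (d : IsDirected _⊑_ s) (u : Carrier) →
                (∀ i → s i ⊑ u) → sup s d ⊑ u
  _≈_ : Carrier → Carrier → Set₁
  x ≈ y = (x ⊑ y) × (y ⊑ x)

open DCPO public using (Carrier)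

module _ (D : DCPO) where
  open DCPO D hiding (Carrier)
  sup-irr : ∀ {I : Set} (s : I → Carrier D) (d d' : IsDirected _⊑_ s) → sup s d ⊑ sup s d'
  sup-irr s d d' = sup-least s d (sup s d') (sup-ub s d')

record Scott (D E : DCPO) : Set₁ where
  private
    module D = DCPO D
    module E = DCPO E
  field
    fun  : Carrier D → Carrier E
    mono : ∀ {x y} → x D.⊑ y → fun x E.⊑ fun y
    -- preservation of directed suprema (the reverse inequality follows
    -- from monotonicity)
    cont : ∀ {I : Set} (s : I → Carrier D) (d : IsDirected D._⊑_ s)
           (d' : IsDirected E._⊑_ (fun ∘ s)) →
           fun (D.sup s d) E.⊑ E.sup (fun ∘ s) d'
open Scott public

monoDir : ∀ {D E} (f : Scott D E) {I : Set} {s : I → Carrier D} →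
          IsDirected (DCPO._⊑_ D) s → IsDirected (DCPO._⊑_ E) (fun f ∘ s)
monoDir f d = record { elt = elt d ; up = λ i j → let (k , p , q) = up d i j in k , mono f p , mono f q }

𝟙ᵈ : DCPO
𝟙ᵈ = record
  { Carrier = Lift _ ⊤ ; _⊑_ = λ _ _ → Lift _ ⊤ ; ⊑-refl = lift tt ; ⊑-trans = λ _ _ → lift tt
  ; sup = λ _ _ → lift tt ; sup-ub = λ _ _ _ → lift tt ; sup-least = λ _ _ _ _ → lift tt }

_×ᵈ_ : DCPO → DCPO → DCPO
D ×ᵈ E = record
  { Carrier = Carrier D × Carrier E
  ; _⊑_ = λ x y → (proj₁ x D.⊑ proj₁ y) × (proj₂ x E.⊑ proj₂ y)
  ; ⊑-refl = D.⊑-refl , E.⊑-refl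
  ; ⊑-trans = λ p q → D.⊑-trans (proj₁ p) (proj₁ q) , E.⊑-trans (proj₂ p) (proj₂ q)
  ; sup = λ s d → D.sup (proj₁ ∘ s) (d₁ d) , E.sup (proj₂ ∘ s) (d₂ d)
  ; sup-ub = λ s d i → D.sup-ub (proj₁ ∘ s) (d₁ d) i , E.sup-ub (proj₂ ∘ s) (d₂ d) i
  ; sup-least = λ s d u h → D.sup-least (proj₁ ∘ s) (d₁ d) (proj₁ u) (proj₁ ∘ h)
                          , E.sup-least (proj₂ ∘ s) (d₂ d) (proj₂ u) (proj₂ ∘ h)
  }
  where
  module D = DCPO D
  module E = DCPO E
  d₁ : ∀ {I : Set} {s : I → Carrier D × Carrier E} →
       IsDirected (λ x y → (proj₁ x D.⊑ proj₁ y) × (proj₂ x E.⊑ proj₂ y)) s →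
       IsDirected D._⊑_ (proj₁ ∘ s)
  d₁ d = record { elt = elt d ; up = λ i j → let (k , p , q) = up d i j in k , proj₁ p , proj₁ q }
  d₂ : ∀ {I : Set} {s : I → Carrier D × Carrier E} →
       IsDirected (λ x y → (proj₁ x D.⊑ proj₁ y) × (proj₂ x E.⊑ proj₂ y)) s →
       IsDirected E._⊑_ (proj₂ ∘ s)
  d₂ d = record { elt = elt d ; up = λ i j → let (k , p , q) = up d i j in k , proj₂ p , proj₂ q }

ptDir : ∀ {D E} {I : Set} {s : I → Scott D E} →
        IsDirected (λ f g → ∀ x → DCPO._⊑_ E (fun f x) (fun g x)) s →
        (x : Carrier D) → IsDirected (DCPO._⊑_ E) (λ i → fun (s i) x)
ptDir d x = record { elt = elt d ; up = λ i j → let (k , p , q) = up d i j in k , p x , q x }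

_⇒ᵈ_ : DCPO → DCPO → DCPO
D ⇒ᵈ E = record
  { Carrier = Scott D E
  ; _⊑_ = _≤_
  ; ⊑-refl = λ x → E.⊑-refl
  ; ⊑-trans = λ p q x → E.⊑-trans (p x) (q x)
  ; sup = supF
  ; sup-ub = λ s d i x → E.sup-ub (λ j → fun (s j) x) (ptDir d x) i
  ; sup-least = λ s d u h x → E.sup-least (λ j → fun (s j) x) (ptDir d x) (fun u x) (λ i → h i x)
  }
  where
  module D = DCPO D
  module E = DCPO E
  _≤_ : Scott D E → Scott D E → Set₁
  f ≤ g = ∀ x → fun f x E.⊑ fun g x
  supF : ∀ {I : Set} (s : I → Scott D E) → IsDirected _≤_ s → Scott D E
  supF s d = record
    { fun = λ x → E.sup (λ i → fun (s i) x) (ptDir d x)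
    ; mono = λ {x} {y} p → E.sup-least _ (ptDir d x) _ λ i →
        E.⊑-trans (mono (s i) p) (E.sup-ub (λ j → fun (s j) y) (ptDir d y) i)
    ; cont = λ t dt d' → E.sup-least _ (ptDir d (D.sup t dt)) _ λ i →
        E.⊑-trans (cont (s i) t dt (monoDir (s i) dt))
          (E.sup-least _ (monoDir (s i) dt) _ λ j →
            E.⊑-trans (E.sup-ub (λ i' → fun (s i') (t j)) (ptDir d (t j)) i)
                      (E.sup-ub _ d' j))
    }

Envᵈ : DCPO → DCPO
Envᵈ D = record
  { Carrier = ℕ → Carrier D
  ; _⊑_ = λ ρ σ → ∀ n → ρ n D.⊑ σ n
  ; ⊑-refl = λ n → D.⊑-refl
  ; ⊑-trans = λ p q n → D.⊑-trans (p n) (q n)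
  ; sup = λ s d n → D.sup (λ i → s i n) (dn d n)
  ; sup-ub = λ s d i n → D.sup-ub (λ j → s j n) (dn d n) i
  ; sup-least = λ s d u h n → D.sup-least (λ j → s j n) (dn d n) (u n) (λ i → h i n)
  }
  where
  module D = DCPO D
  dn : ∀ {I : Set} {s : I → ℕ → Carrier D} →
       IsDirected (λ ρ σ → ∀ n → ρ n D.⊑ σ n) s → (n : ℕ) → IsDirected D._⊑_ (λ i → s i n)
  dn d n = record { elt = elt d ; up = λ i j → let (k , p , q) = up d i j in k , p n , q n }

_∘S_ : ∀ {D E F} → Scott E F → Scott D E → Scott D F
_∘S_ {D} {E} {F} g f = record
  { fun = fun g ∘ fun f
  ; mono = mono g ∘ mono f
  ; cont = λ s d d' → DCPO.⊑-trans F (mono g (cont f s d (monoDir f d))) (cont g (fun f ∘ s) (monoDir f d) d')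
  }

constS : ∀ {D E} → Carrier E → Scott D E
constS {D} {E} c = record
  { fun = λ _ → c ; mono = λ _ → DCPO.⊑-refl E
  ; cont = λ s d d' → DCPO.sup-ub E (λ _ → c) d' (elt d) }

pairS : ∀ {C D E} → Scott C D → Scott C E → Scott C (D ×ᵈ E)
pairS {C} {D} {E} f g = record
  { fun = λ x → fun f x , fun g x
  ; mono = λ p → mono f p , mono g p
  ; cont = λ s d d' → cont f s d _ , cont g s d _
  }

projS : ∀ {D} (n : ℕ) → Scott (Envᵈ D) D
projS {D} n = record
  { fun = λ ρ → ρ n ; mono = λ p → p n
  ; cont = λ s d d' → sup-irr D (λ i → s i n) _ d' }

_∷ₑ_ : ∀ {A : Set₁} → A → (ℕ → A) → ℕ → A
(d ∷ₑ ρ) zero    = d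
(d ∷ₑ ρ) (suc n) = ρ n

consS : ∀ {D} → Scott (Envᵈ D ×ᵈ D) (Envᵈ D)
consS {D} = record
  { fun = λ p → proj₂ p ∷ₑ proj₁ p
  ; mono = λ { p zero → proj₂ p ; p (suc n) → proj₁ p n }
  ; cont = λ { s d d' zero → sup-irr D (λ i → proj₂ (s i)) _ _
             ; s d d' (suc n) → sup-irr D (λ i → proj₁ (s i) n) _ _ }
  }

curryS : ∀ {A B C} → Scott (A ×ᵈ B) C → Scott A (B ⇒ᵈ C)
curryS {A} {B} {C} f = record
  { fun = λ a → record
      { fun = λ b → fun f (a , b)
      ; mono = λ p → mono f (A.⊑-refl , p)
      ; cont = λ s d d' → C.⊑-trans
          (mono f (A.sup-ub (λ _ → a) _ (elt d) , sup-irr B s d _))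
          (cont f (λ i → a , s i) (pairDirR a d) d')
      }
  ; mono = λ p b → mono f (p , B.⊑-refl)
  ; cont = λ s d d' b → C.⊑-trans
      (mono f (sup-irr A s d _ , B.sup-ub (λ _ → b) _ (elt d)))
      (cont f (λ i → s i , b) (pairDirL b d) (ptDir d' b))
  }
  where
  module A = DCPO A
  module B = DCPO B
  module C = DCPO C
  pairDirR : ∀ {I : Set} (a : Carrier A) {s : I → Carrier B} → IsDirected B._⊑_ s →
             IsDirected (DCPO._⊑_ (A ×ᵈ B)) (λ i → a , s i)
  pairDirR a d = record { elt = elt d ; up = λ i j → let (k , p , q) = up d i j in k , (A.⊑-refl , p) , (A.⊑-refl , q) }
  pairDirL : ∀ {I : Set} (b : Carrier B) {s : I → Carrier A} → IsDirected A._⊑_ s →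
             IsDirected (DCPO._⊑_ (A ×ᵈ B)) (λ i → s i , b)
  pairDirL b d = record { elt = elt d ; up = λ i j → let (k , p , q) = up d i j in k , (p , B.⊑-refl) , (q , B.⊑-refl) }

-- A cartesian closed (full) subcategory 𝒟 of DCPO: a class of objects
-- containing the terminal object and closed under × and [_→_].

record CCSubcat : Set₂ where
  field
    Ob     : DCPO → Set₁
    Ob-𝟙   : Ob 𝟙ᵈ
    Ob-×   : ∀ {D E} → Ob D → Ob E → Ob (D ×ᵈ E)
    Ob-⇒   : ∀ {D E} → Ob D → Ob E → Ob (D ⇒ᵈ E)

record Obj (𝒞 : CCSubcat) : Set₂ where
  field
    dcpo : DCPO
    isOb : CCSubcat.Ob 𝒞 dcpo
open Obj public

-- A monad (T, unit, ⋆) over 𝒟 (Kleisli-triple form)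

record Monad (𝒞 : CCSubcat) : Set₂ where
  field
    T     : Obj 𝒞 → Obj 𝒞
    unit  : (A : Obj 𝒞) → Scott (dcpo A) (dcpo (T A))
    star  : (A B : Obj 𝒞) → Scott (dcpo (T A) ×ᵈ (dcpo A ⇒ᵈ dcpo (T B))) (dcpo (T B))
    law-unitˡ : ∀ (A B : Obj 𝒞) (d : Carrier (dcpo A)) (f : Scott (dcpo A) (dcpo (T B))) →
                DCPO._≈_ (dcpo (T B)) (fun (star A B) (fun (unit A) d , f)) (fun f d)
    law-unitʳ : ∀ (A : Obj 𝒞) (a : Carrier (dcpo (T A))) →
                DCPO._≈_ (dcpo (T A)) (fun (star A A) (a , unit A)) a
    law-assoc : ∀ (A B C : Obj 𝒞) (a : Carrier (dcpo (T A)))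
                (f : Scott (dcpo A) (dcpo (T B))) (g : Scott (dcpo B) (dcpo (T C))) →
                DCPO._≈_ (dcpo (T C))
                  (fun (star B C) (fun (star A B) (a , f) , g))
                  (fun (star A C) (a , (star B C ∘S pairS {dcpo A} {dcpo (T B)} {dcpo B ⇒ᵈ dcpo (T C)} f (constS g))))

record TModel (𝒞 : CCSubcat) (𝕄 : Monad 𝒞) : Set₂ where
  open Monad 𝕄
  field
    D   : Obj 𝒞
    Φ   : Scott (dcpo D) (dcpo D ⇒ᵈ dcpo (T D))
    Ψ   : Scott (dcpo D ⇒ᵈ dcpo (T D)) (dcpo D)
    ΦΨ  : ∀ (f : Scott (dcpo D) (dcpo (T D))) →
          DCPO._≈_ (dcpo D ⇒ᵈ dcpo (T D)) (fun Φ (fun Ψ f)) f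

-- Syntax of λ_c^u (de Bruijn indices; Var = ℕ)

mutual
  data Val : Set where
    var : ℕ → Val
    lam : Comp → Val

  data Comp : Set where
    unitₜ : Val → Comp
    _⋆_   : Comp → Val → Comp

ext : (ℕ → ℕ) → ℕ → ℕ
ext r zero    = zero
ext r (suc n) = suc (r n)

mutual
  renV : (ℕ → ℕ) → Val → Val
  renV r (var n) = var (r n)
  renV r (lam M) = lam (renC (ext r) M)

  renC : (ℕ → ℕ) → Comp → Comp
  renC r (unitₜ V) = unitₜ (renV r V)
  renC r (M ⋆ V)   = renC r M ⋆ renV r V

exts : (ℕ → Val) → ℕ → Val
exts σ zero    = var zero
exts σ (suc n) = renV suc (σ n)

mutual
  subV : (ℕ → Val) → Val → Val
  subV σ (var n) = σ n
  subV σ (lam M) = lam (subC (exts σ) M)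

  subC : (ℕ → Val) → Comp → Comp
  subC σ (unitₜ V) = unitₜ (subV σ V)
  subC σ (M ⋆ V)   = subC σ M ⋆ subV σ V

_[_] : Comp → Val → Comp
M [ V ] = subC σ M
  where
  σ : ℕ → Val
  σ zero    = V
  σ (suc n) = var n

mutual
  data _⟶_ : Comp → Comp → Set where
    β     : ∀ {V M} → (unitₜ V ⋆ lam M) ⟶ (M [ V ])
    η     : ∀ {M} → (M ⋆ lam (unitₜ (var zero))) ⟶ M
    -- (L ⋆ λx.M) ⋆ λy.N → L ⋆ λx.(M ⋆ λy.N),  x ∉ FV(N): N is weakened
    -- past the new binder x (index 1 inside λx.λy).
    assoc : ∀ {L M N} → ((L ⋆ lam M) ⋆ lam N) ⟶ (L ⋆ lam (M ⋆ lam (renC (ext suc) N)))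
    ξ-unit : ∀ {V V'} → V ⟶ᵛ V' → unitₜ V ⟶ unitₜ V'
    ξ-⋆ˡ   : ∀ {M M' V} → M ⟶ M' → (M ⋆ V) ⟶ (M' ⋆ V)
    ξ-⋆ʳ   : ∀ {M V V'} → V ⟶ᵛ V' → (M ⋆ V) ⟶ (M ⋆ V')

  data _⟶ᵛ_ : Val → Val → Set where
    ξ-lam : ∀ {M M'} → M ⟶ M' → lam M ⟶ᵛ lam M'

_≅_ : Comp → Comp → Set
_≅_ = EqClosure _⟶_

-- Each term denotes a Scott-continuous
-- map from environments; ⟦ M ⟧ᶜ ρ is its value at ρ.  Definitionally:
--   ⟦ var x ⟧ᵛ ρ     = ρ x
--   ⟦ lam M ⟧ᵛ ρ     = Ψ (d ↦ ⟦ M ⟧ᶜ (d ∷ ρ))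
--   ⟦ unitₜ V ⟧ᶜ ρ   = unit (⟦ V ⟧ᵛ ρ)
--   ⟦ M ⋆ V ⟧ᶜ ρ     = ⟦ M ⟧ᶜ ρ ⋆ Φ (⟦ V ⟧ᵛ ρ)

module Semantics {𝒞 : CCSubcat} {𝕄 : Monad 𝒞} (ℳ : TModel 𝒞 𝕄) where
  open Monad 𝕄
  open TModel ℳ

  𝔻 : DCPO
  𝔻 = dcpo D

  𝕋𝔻 : DCPO
  𝕋𝔻 = dcpo (T D)

  Env : Set₁
  Env = ℕ → Carrier 𝔻

  mutual
    ⟦_⟧ⱽ : Val → Scott (Envᵈ 𝔻) 𝔻
    ⟦ var n ⟧ⱽ = projS n
    ⟦ lam M ⟧ⱽ = Ψ ∘S curryS {Envᵈ 𝔻} {𝔻} {𝕋𝔻} (⟦ M ⟧ᶜᵒ ∘S consS {𝔻})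

    ⟦_⟧ᶜᵒ : Comp → Scott (Envᵈ 𝔻) 𝕋𝔻
    ⟦ unitₜ V ⟧ᶜᵒ = unit D ∘S ⟦ V ⟧ⱽ
    ⟦ M ⋆ V ⟧ᶜᵒ   = star D D ∘S pairS {Envᵈ 𝔻} {𝕋𝔻} {𝔻 ⇒ᵈ 𝕋𝔻} ⟦ M ⟧ᶜᵒ (Φ ∘S ⟦ V ⟧ⱽ)

  ⟦_⟧ᵛ : Val → Env → Carrier 𝔻
  ⟦ V ⟧ᵛ ρ = fun ⟦ V ⟧ⱽ ρ

  ⟦_⟧ᶜ : Comp → Env → Carrier 𝕋𝔻
  ⟦ M ⟧ᶜ ρ = fun ⟦ M ⟧ᶜᵒ ρ

  _≈ᵀ_ : Carrier 𝕋𝔻 → Carrier 𝕋𝔻 → Set₁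
  _≈ᵀ_ = DCPO._≈_ 𝕋𝔻

  private
    module _ where
      open import Relation.Binary.PropositionalEquality using (_≡_; refl)
      clause-var : ∀ n ρ → ⟦ var n ⟧ᵛ ρ ≡ ρ n
      clause-var n ρ = refl
      clause-lam : ∀ M ρ → ⟦ lam M ⟧ᵛ ρ ≡ fun Ψ (fun (curryS {Envᵈ 𝔻} {𝔻} {𝕋𝔻} (⟦ M ⟧ᶜᵒ ∘S consS {𝔻})) ρ)
      clause-lam M ρ = refl
      clause-lam-fun : ∀ M ρ d → fun (fun (curryS {Envᵈ 𝔻} {𝔻} {𝕋𝔻} (⟦ M ⟧ᶜᵒ ∘S consS {𝔻})) ρ) d ≡ ⟦ M ⟧ᶜ (d ∷ₑ ρ)
      clause-lam-fun M ρ d = refl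
      clause-unit : ∀ V ρ → ⟦ unitₜ V ⟧ᶜ ρ ≡ fun (unit D) (⟦ V ⟧ᵛ ρ)
      clause-unit V ρ = refl
      clause-star : ∀ M V ρ → ⟦ M ⋆ V ⟧ᶜ ρ ≡ fun (star D D) (⟦ M ⟧ᶜ ρ , fun Φ (⟦ V ⟧ᵛ ρ))
      clause-star M V ρ = refl

-- Interpretations are monotone in the environment and in every subterm, so
-- equality in the poset TD is preserved by all contexts and only the three
-- redexes need checking. Once Φ ∘ Ψ = id has unwound each λ to the function it
-- denotes, β is the left unit law, η the right unit law and assoc the
-- associativity law of the monad; the only syntactic input is the substitution
-- lemma, which gives both the β-contractum and the weakening of N in assoc.
module Submission where

open import Defs
open import Level using (0ℓ) renaming (suc to lsuc)
open import Data.Nat using (zero; suc)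
open import Data.Product using (_×_; _,_; proj₁; proj₂)
open import Function using (_∘_)
open import Relation.Binary.Bundles using (Setoid)
open import Relation.Binary.Structures using (IsEquivalence)
import Relation.Binary.Construct.Closure.Equivalence as EqClosure
import Relation.Binary.Reasoning.Setoid as SetoidReasoning

module _ (D : DCPO) where
  open DCPO D hiding (Carrier)

  ≈-isEquivalence : IsEquivalence _≈_
  ≈-isEquivalence = record
    { refl  = ⊑-refl , ⊑-refl
    ; sym   = λ (p , q) → q , p
    ; trans = λ (p , q) (p' , q') → ⊑-trans p p' , ⊑-trans q' q
    }

  setoid : Setoid (lsuc 0ℓ) (lsuc 0ℓ)
  setoid = record { isEquivalence = ≈-isEquivalence }

fun-cong : ∀ {D E} (f : Scott D E) {x y : Carrier D} →
           DCPO._≈_ D x y → DCPO._≈_ E (fun f x) (fun f y)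
fun-cong f (p , q) = mono f p , mono f q

module Soundness {𝒞 : CCSubcat} {𝕄 : Monad 𝒞} (ℳ : TModel 𝒞 𝕄) where
  open Monad 𝕄
  open TModel ℳ
  open Semantics ℳ
  open IsEquivalence (≈-isEquivalence 𝕋𝔻) using () renaming (refl to ≈ᵀ-refl; sym to ≈ᵀ-sym; trans to ≈ᵀ-trans)
  open IsEquivalence (≈-isEquivalence 𝔻) using () renaming (refl to ≈ᴰ-refl)
  open SetoidReasoning (setoid 𝕋𝔻)

  _≈ᴰ_ : Carrier 𝔻 → Carrier 𝔻 → Set₁
  _≈ᴰ_ = DCPO._≈_ 𝔻

  record _≈ᶠ_ (f g : Scott 𝔻 𝕋𝔻) : Set₁ where
    constructor pointwise
    field app : ∀ d → fun f d ≈ᵀ fun g d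

  ≈ᶠ-sym : ∀ {f g} → f ≈ᶠ g → g ≈ᶠ f
  ≈ᶠ-sym (pointwise p) = pointwise λ d → ≈ᵀ-sym (p d)

  ≈ᶠ-trans : ∀ {f g h} → f ≈ᶠ g → g ≈ᶠ h → f ≈ᶠ h
  ≈ᶠ-trans (pointwise p) (pointwise q) = pointwise λ d → ≈ᵀ-trans (p d) (q d)

  _>=>_ : Scott 𝔻 𝕋𝔻 → Scott 𝔻 𝕋𝔻 → Scott 𝔻 𝕋𝔻
  f >=> g = star D D ∘S pairS {𝔻} {𝕋𝔻} {𝔻 ⇒ᵈ 𝕋𝔻} f (constS g)

  ⟦_⟧ˡ : Comp → Env → Scott 𝔻 𝕋𝔻
  ⟦ M ⟧ˡ ρ = fun (curryS {Envᵈ 𝔻} {𝔻} {𝕋𝔻} (⟦ M ⟧ᶜᵒ ∘S consS {𝔻})) ρ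

  star-cong : ∀ {a a' : Carrier 𝕋𝔻} {f f' : Scott 𝔻 𝕋𝔻} → a ≈ᵀ a' → f ≈ᶠ f' →
              fun (star D D) (a , f) ≈ᵀ fun (star D D) (a' , f')
  star-cong (p , p') (pointwise q) = mono (star D D) (p , proj₁ ∘ q) , mono (star D D) (p' , proj₂ ∘ q)

  Ψ-cong : ∀ {f g : Scott 𝔻 𝕋𝔻} → f ≈ᶠ g → fun Ψ f ≈ᴰ fun Ψ g
  Ψ-cong (pointwise q) = mono Ψ (proj₁ ∘ q) , mono Ψ (proj₂ ∘ q)

  Φ-cong : ∀ {v w : Carrier 𝔻} → v ≈ᴰ w → fun Φ v ≈ᶠ fun Φ w
  Φ-cong (p , p') = pointwise λ d → mono Φ p d , mono Φ p' d

  Φ-lam : ∀ M ρ → fun Φ (⟦ lam M ⟧ᵛ ρ) ≈ᶠ ⟦ M ⟧ˡ ρ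
  Φ-lam M ρ = let (p , p') = ΦΨ (⟦ M ⟧ˡ ρ) in pointwise λ d → p d , p' d

  ⟦⟧ᶜ-cong : ∀ M {ρ σ : Env} → (∀ n → ρ n ≈ᴰ σ n) → ⟦ M ⟧ᶜ ρ ≈ᵀ ⟦ M ⟧ᶜ σ
  ⟦⟧ᶜ-cong M h = mono ⟦ M ⟧ᶜᵒ (proj₁ ∘ h) , mono ⟦ M ⟧ᶜᵒ (proj₂ ∘ h)

  mutual
    renV-sound : ∀ r V ρ → ⟦ renV r V ⟧ᵛ ρ ≈ᴰ ⟦ V ⟧ᵛ (ρ ∘ r)
    renV-sound r (var n) ρ = ≈ᴰ-refl
    renV-sound r (lam M) ρ = Ψ-cong (pointwise λ d → begin
      ⟦ renC (ext r) M ⟧ᶜ (d ∷ₑ ρ)    ≈⟨ renC-sound (ext r) M (d ∷ₑ ρ) ⟩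
      ⟦ M ⟧ᶜ ((d ∷ₑ ρ) ∘ ext r)       ≈⟨ ⟦⟧ᶜ-cong M (λ { zero → ≈ᴰ-refl ; (suc n) → ≈ᴰ-refl }) ⟩
      ⟦ M ⟧ᶜ (d ∷ₑ (ρ ∘ r))           ∎)

    renC-sound : ∀ r M ρ → ⟦ renC r M ⟧ᶜ ρ ≈ᵀ ⟦ M ⟧ᶜ (ρ ∘ r)
    renC-sound r (unitₜ V) ρ = fun-cong (unit D) (renV-sound r V ρ)
    renC-sound r (M ⋆ V)   ρ = star-cong (renC-sound r M ρ) (Φ-cong (renV-sound r V ρ))

  mutual
    subV-sound : ∀ σ V ρ → ⟦ subV σ V ⟧ᵛ ρ ≈ᴰ ⟦ V ⟧ᵛ (λ n → ⟦ σ n ⟧ᵛ ρ)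
    subV-sound σ (var n) ρ = ≈ᴰ-refl
    subV-sound σ (lam M) ρ = Ψ-cong (pointwise λ d → begin
      ⟦ subC (exts σ) M ⟧ᶜ (d ∷ₑ ρ)                 ≈⟨ subC-sound (exts σ) M (d ∷ₑ ρ) ⟩
      ⟦ M ⟧ᶜ (λ n → ⟦ exts σ n ⟧ᵛ (d ∷ₑ ρ))         ≈⟨ ⟦⟧ᶜ-cong M (λ
                                                        { zero → ≈ᴰ-refl
                                                        ; (suc n) → renV-sound suc (σ n) (d ∷ₑ ρ) }) ⟩
      ⟦ M ⟧ᶜ (d ∷ₑ (λ n → ⟦ σ n ⟧ᵛ ρ))              ∎)

    subC-sound : ∀ σ M ρ → ⟦ subC σ M ⟧ᶜ ρ ≈ᵀ ⟦ M ⟧ᶜ (λ n → ⟦ σ n ⟧ᵛ ρ)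
    subC-sound σ (unitₜ V) ρ = fun-cong (unit D) (subV-sound σ V ρ)
    subC-sound σ (M ⋆ V)   ρ = star-cong (subC-sound σ M ρ) (Φ-cong (subV-sound σ V ρ))

  []-sound : ∀ M V ρ → ⟦ M [ V ] ⟧ᶜ ρ ≈ᵀ ⟦ M ⟧ᶜ (⟦ V ⟧ᵛ ρ ∷ₑ ρ)
  []-sound M V ρ = ≈ᵀ-trans (subC-sound _ M ρ)
    (⟦⟧ᶜ-cong M (λ { zero → ≈ᴰ-refl ; (suc n) → ≈ᴰ-refl }))

  weaken₁-sound : ∀ N d e ρ → ⟦ renC (ext suc) N ⟧ᶜ (e ∷ₑ (d ∷ₑ ρ)) ≈ᵀ ⟦ N ⟧ᶜ (e ∷ₑ ρ)
  weaken₁-sound N d e ρ = begin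
    ⟦ renC (ext suc) N ⟧ᶜ (e ∷ₑ (d ∷ₑ ρ))    ≈⟨ renC-sound (ext suc) N (e ∷ₑ (d ∷ₑ ρ)) ⟩
    ⟦ N ⟧ᶜ ((e ∷ₑ (d ∷ₑ ρ)) ∘ ext suc)       ≈⟨ ⟦⟧ᶜ-cong N (λ { zero → ≈ᴰ-refl ; (suc n) → ≈ᴰ-refl }) ⟩
    ⟦ N ⟧ᶜ (e ∷ₑ ρ)                          ∎

  Φ-lam-⋆-lam : ∀ M N ρ → fun Φ (⟦ lam (M ⋆ lam (renC (ext suc) N)) ⟧ᵛ ρ) ≈ᶠ (⟦ M ⟧ˡ ρ >=> ⟦ N ⟧ˡ ρ)
  Φ-lam-⋆-lam M N ρ = ≈ᶠ-trans (Φ-lam (M ⋆ lam (renC (ext suc) N)) ρ) (pointwise λ d →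
    star-cong ≈ᵀ-refl (≈ᶠ-trans (Φ-lam (renC (ext suc) N) (d ∷ₑ ρ)) (pointwise λ e → weaken₁-sound N d e ρ)))

  mutual
    ⟶-sound : ∀ {M N} → M ⟶ N → ∀ ρ → ⟦ M ⟧ᶜ ρ ≈ᵀ ⟦ N ⟧ᶜ ρ
    ⟶-sound (β {V} {M}) ρ = begin
      fun (star D D) (fun (unit D) (⟦ V ⟧ᵛ ρ) , fun Φ (⟦ lam M ⟧ᵛ ρ))  ≈⟨ star-cong ≈ᵀ-refl (Φ-lam M ρ) ⟩
      fun (star D D) (fun (unit D) (⟦ V ⟧ᵛ ρ) , ⟦ M ⟧ˡ ρ)              ≈⟨ law-unitˡ D D (⟦ V ⟧ᵛ ρ) (⟦ M ⟧ˡ ρ) ⟩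
      ⟦ M ⟧ᶜ (⟦ V ⟧ᵛ ρ ∷ₑ ρ)                                         ≈⟨ ≈ᵀ-sym ([]-sound M V ρ) ⟩
      ⟦ M [ V ] ⟧ᶜ ρ                                                 ∎
    ⟶-sound (η {M}) ρ = begin
      fun (star D D) (⟦ M ⟧ᶜ ρ , fun Φ (⟦ lam (unitₜ (var zero)) ⟧ᵛ ρ))  ≈⟨ star-cong ≈ᵀ-refl (Φ-lam (unitₜ (var zero)) ρ) ⟩
      fun (star D D) (⟦ M ⟧ᶜ ρ , ⟦ unitₜ (var zero) ⟧ˡ ρ)               ≈⟨ star-cong ≈ᵀ-refl (pointwise λ _ → ≈ᵀ-refl) ⟩
      fun (star D D) (⟦ M ⟧ᶜ ρ , unit D)                                ≈⟨ law-unitʳ D (⟦ M ⟧ᶜ ρ) ⟩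
      ⟦ M ⟧ᶜ ρ                                                          ∎
    ⟶-sound (assoc {L} {M} {N}) ρ = begin
      fun (star D D) (fun (star D D) (⟦ L ⟧ᶜ ρ , fun Φ (⟦ lam M ⟧ᵛ ρ)) , fun Φ (⟦ lam N ⟧ᵛ ρ))
        ≈⟨ star-cong (star-cong ≈ᵀ-refl (Φ-lam M ρ)) (Φ-lam N ρ) ⟩
      fun (star D D) (fun (star D D) (⟦ L ⟧ᶜ ρ , ⟦ M ⟧ˡ ρ) , ⟦ N ⟧ˡ ρ)
        ≈⟨ law-assoc D D D (⟦ L ⟧ᶜ ρ) (⟦ M ⟧ˡ ρ) (⟦ N ⟧ˡ ρ) ⟩
      fun (star D D) (⟦ L ⟧ᶜ ρ , ⟦ M ⟧ˡ ρ >=> ⟦ N ⟧ˡ ρ)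
        ≈⟨ star-cong ≈ᵀ-refl (≈ᶠ-sym (Φ-lam-⋆-lam M N ρ)) ⟩
      ⟦ L ⋆ lam (M ⋆ lam (renC (ext suc) N)) ⟧ᶜ ρ
        ∎
    ⟶-sound (ξ-unit V⟶V') ρ = fun-cong (unit D) (⟶ᵛ-sound V⟶V' ρ)
    ⟶-sound (ξ-⋆ˡ M⟶M')   ρ = star-cong (⟶-sound M⟶M' ρ) (pointwise λ _ → ≈ᵀ-refl)
    ⟶-sound (ξ-⋆ʳ V⟶V')   ρ = star-cong ≈ᵀ-refl (Φ-cong (⟶ᵛ-sound V⟶V' ρ))

    ⟶ᵛ-sound : ∀ {V W} → V ⟶ᵛ W → ∀ ρ → ⟦ V ⟧ᵛ ρ ≈ᴰ ⟦ W ⟧ᵛ ρ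
    ⟶ᵛ-sound (ξ-lam M⟶M') ρ = Ψ-cong (pointwise λ d → ⟶-sound M⟶M' (d ∷ₑ ρ))

  ≅-sound : ∀ {M N} → M ≅ N → ∀ ρ → ⟦ M ⟧ᶜ ρ ≈ᵀ ⟦ N ⟧ᶜ ρ
  ≅-sound M≅N ρ = EqClosure.gfold (≈-isEquivalence 𝕋𝔻) (λ M → ⟦ M ⟧ᶜ ρ) (λ M⟶N → ⟶-sound M⟶N ρ) M≅N

mainTheorem5 : (𝒞 : CCSubcat) (𝕄 : Monad 𝒞) (ℳ : TModel 𝒞 𝕄) →
    let open Semantics ℳ in
    (ρ : Env) →
    (∀ {M N : Comp} → M ⟶ N → ⟦ M ⟧ᶜ ρ ≈ᵀ ⟦ N ⟧ᶜ ρ) ×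
    (∀ {M N : Comp} → M ≅ N → ⟦ M ⟧ᶜ ρ ≈ᵀ ⟦ N ⟧ᶜ ρ)
mainTheorem5 𝒞 𝕄 ℳ ρ = (λ M⟶N → ⟶-sound M⟶N ρ) , (λ M≅N → ≅-sound M≅N ρ)
  where open Soundness ℳ
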